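{- For every digraph $D$ and every maximally condensed subdigraph $D^*$ of $D$, $\dim(D)=\dim(D^*)$.
   Context: All digraphs are finite and have simple underlying graphs. For an integer $d\ge 0$ write $[d]=\{1,\dots,d\}$ (with $\mathbb{R}^0=\{0\}$). For $x,y\in\mathbb{R}^d$ let $\mathcal{G}_{x>y}=\{i\in[d]: x_i>y_i\}$. The weak majority relation: $x\succ y$ iff $|\mathcal{G}_{x>y}|-|\mathcal{G}_{y>x}|>0$. A map $f:V(D)\to\mathbb{R}^d$ is an $\mathbb{R}^d$-realizer of $D$ if for all vertices $x,y$: $(x,y)\in A(D)$ iff $f(x)\succ f(y)$. The weak majority dimension $\dim(D)$ is the minimum nonnegative integer $d$ such that $D$ has an $\mathbb{R}^d$-realizer (such $d$ always exists). Two vertices $u,v$ of $D$ are homogeneous, $u\sim v$, if $N^+_D(u)=N^+_D(v)$ and $N^-_D(u)=N^-_D(v)$ (out- and in-neighbourhoods); this is an equivalence relation. A maximally condensed subdigraph of $D$ is a subdigraph induced by a set containing exactly one vertex from each $\sim$-equivalence class.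
   Formalization: Realizers take values in ℚ^d instead of $\mathbb{R}^d$. -}

module Defs where

open import Data.Nat using (ℕ; _<_; _≤_)
open import Data.Fin using (Fin)
open import Data.Bool using (Bool; true; false)
open import Data.List using (length; filter; allFin)
open import Data.Rational using (ℚ) renaming (_<?_ to _<ℚ?_; _<_ to _<ℚ_)
open import Data.Product using (Σ; _×_; ∃)
open import Function.Bundles using (_⇔_)
open import Relation.Binary.PropositionalEquality using (_≡_; _≢_)
open import Relation.Nullary using (¬_)

record Digraph : Set where
  field
    order      : ℕ
    arc        : Fin order → Fin order → Bool
    loopless   : ∀ u → arc u u ≡ false
    asymmetric : ∀ u v → arc u v ≡ true → arc v u ≡ false
open Digraph public

Point : ℕ → Set
Point d = Fin d → ℚ

countGt : ∀ {d} → Point d → Point d → ℕ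
countGt {d} x y = length (filter (λ i → y i <ℚ? x i) (allFin d))

_≻_ : ∀ {d} → Point d → Point d → Set
x ≻ y = countGt y x < countGt x y

Realizable : Digraph → ℕ → Set
Realizable D d = Σ (Fin (order D) → Point d) λ f →
    ∀ x y → (arc D x y ≡ true) ⇔ (f x ≻ f y)

IsDim : Digraph → ℕ → Set
IsDim D d = Realizable D d × (∀ d′ → Realizable D d′ → d ≤ d′)

Homogeneous : (D : Digraph) → Fin (order D) → Fin (order D) → Set
Homogeneous D u v =
  (∀ w → arc D u w ≡ arc D v w) × (∀ w → arc D w u ≡ arc D w v)

-- Subdigraph of D induced by the vertex set enumerated by ι : Fin m → Fin n
-- (ι injective is assumed where needed).
induced : (D : Digraph) {m : ℕ} → (Fin m → Fin (order D)) → Digraph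
induced D {m} ι = record
  { order = m
  ; arc = λ i j → arc D (ι i) (ι j)
  ; loopless = λ i → loopless D (ι i)
  ; asymmetric = λ i j → asymmetric D (ι i) (ι j)
  }

IsCondensingSet : (D : Digraph) {m : ℕ} → (Fin m → Fin (order D)) → Set
IsCondensingSet D ι =
  (∀ i j → ι i ≡ ι j → i ≡ j)
  × (∀ v → ∃ λ i → Homogeneous D (ι i) v)
  × (∀ i j → Homogeneous D (ι i) (ι j) → ι i ≡ ι j)

{-# OPTIONS --safe #-}
-- A realizer of D restricts to every induced subdigraph. Conversely, sending
-- each vertex to the representative of its homogeneity class preserves arcs
-- and non-arcs, because homogeneous vertices have the same neighbourhoods; so
-- a realizer of D* extends to D by giving every vertex the point of its
-- representative. Hence D and D* are realizable in exactly the same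
-- dimensions, and in particular have the same minimum.
module Submission where

open import Defs
open import Data.Nat using (ℕ)
open import Data.Fin using (Fin)
open import Data.Bool using (true)
open import Data.Product using (∃; _,_; proj₁; proj₂)
open import Function.Base using (_∘_)
open import Function.Bundles using (_⇔_; mk⇔; Equivalence)
open import Function.Properties.Equivalence using () renaming (sym to ⇔-sym)
open import Relation.Binary.PropositionalEquality using (_≡_; refl; trans; subst)

IsStrongHomomorphism : (D E : Digraph) → (Fin (order D) → Fin (order E)) → Set
IsStrongHomomorphism D E h = ∀ x y → arc E (h x) (h y) ≡ arc D x y

realizable-pullback : (D E : Digraph) (h : Fin (order D) → Fin (order E)) →
                      IsStrongHomomorphism D E h →
                      ∀ {d} → Realizable E d → Realizable D d
realizable-pullback D E h hom (f , realizes) =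
  f ∘ h , λ x y → subst (λ b → (b ≡ true) ⇔ (f (h x) ≻ f (h y))) (hom x y) (realizes (h x) (h y))

induced-inclusion : (D : Digraph) {m : ℕ} (ι : Fin m → Fin (order D)) →
                    IsStrongHomomorphism (induced D ι) D ι
induced-inclusion D ι x y = refl

homogeneous-arc : (D : Digraph) {u u′ v v′ : Fin (order D)} →
                  Homogeneous D u u′ → Homogeneous D v v′ →
                  arc D u v ≡ arc D u′ v′
homogeneous-arc D (sameOut , _) (_ , sameIn) = trans (sameOut _) (sameIn _)

representative-homomorphism :
  (D : Digraph) {m : ℕ} (ι : Fin m → Fin (order D)) →
  (represented : ∀ v → ∃ λ i → Homogeneous D (ι i) v) →
  IsStrongHomomorphism D (induced D ι) (proj₁ ∘ represented)
representative-homomorphism D ι represented x y =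
  homogeneous-arc D (proj₂ (represented x)) (proj₂ (represented y))

isDim-transfer : (D E : Digraph) → (∀ d → Realizable D d ⇔ Realizable E d) →
                 ∀ {d} → IsDim D d → IsDim E d
isDim-transfer D E same (realizer , minimal) =
  Equivalence.to (same _) realizer , λ d′ → minimal d′ ∘ Equivalence.from (same d′)

isDim-cong : (D E : Digraph) → (∀ d → Realizable D d ⇔ Realizable E d) →
             ∀ d → IsDim D d ⇔ IsDim E d
isDim-cong D E same d =
  mk⇔ (isDim-transfer D E same)
      (isDim-transfer E D (⇔-sym ∘ same))

proposition3p1 : (D : Digraph) (m : ℕ) (ι : Fin m → Fin (order D)) →
                 IsCondensingSet D ι →
                 ∀ d → IsDim D d ⇔ IsDim (induced D ι) d
proposition3p1 D m ι (_ , represented , _) =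
  isDim-cong D (induced D ι) λ d →
    mk⇔ (realizable-pullback (induced D ι) D ι (induced-inclusion D ι))
        (realizable-pullback D (induced D ι) (proj₁ ∘ represented)
           (representative-homomorphism D ι represented))
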